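{- Let $k\geq 2$, let $G$ be a graph, and let $(H,p)$ be one of the pairs $(C_k,k)$, $(P_k,2k-2)$, $(P_k^*,2k-1)$, $(P_k^{**},2k)$. Let $e$ be an edge of $G$ and let $G'$ be obtained from $G$ by subdividing $e$ exactly $p$ times (replacing $e=uv$ by a path $u,s_1,\ldots,s_p,v$ through $p$ new vertices). Then $G$ has an $H$-role colouring if and only if $G'$ has an $H$-role colouring.
   Context: Graphs are finite, undirected, without multiple edges, possibly with loops. $P_k$ has vertex set $\{1,\ldots,k\}$ and edges $\{i,i+1\}$, $1\le i<k$; $C_k$ is $P_k$ plus the edge $\{k,1\}$; $P_k^*$ is $P_k$ plus a loop at $k$; $P_k^{**}$ is $P_k$ plus loops at $1$ and $k$. A role colouring of $G$ is a map $r:V(G)\to\mathbb{N}^+$ such that $r(u)=r(v)$ implies $\{r(u'):u'\in N(u)\}=\{r(v'):v'\in N(v)\}$. Its role graph is the graph on the used colours with an edge $\{x,y\}$ (possibly a loop) whenever some vertex of colour $x$ has a neighbour of colour $y$. An $H$-role colouring of $G$ is a role colouring $r:V(G)\to V(H)$ whose role graph is exactly $H$. -}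

module Defs where

open import Data.Bool using (Bool; true; false; _∧_; _∨_; not)
open import Data.Bool.Properties using (∧-comm; ∨-comm)
open import Data.Nat using (ℕ; zero; suc; _≡ᵇ_; _∸_; _+_; _*_)
open import Data.Fin using (Fin; toℕ; splitAt)
open import Data.Fin.Properties using () renaming (_≟_ to _≟F_)
open import Data.Sum using (_⊎_; inj₁; inj₂)
open import Data.Product using (Σ; _×_; _,_)
open import Relation.Nullary.Decidable using (⌊_⌋)
open import Relation.Binary.PropositionalEquality using (_≡_; refl; cong₂; trans)
open import Function.Bundles using (_⇔_)

-- A finite undirected graph, loops allowed, no multi-edges:
-- vertex set Fin n, symmetric Boolean adjacency (adj x x = true is a loop).
record Graph : Set where
  field
    n   : ℕ
    adj : Fin n → Fin n → Bool
    sym : ∀ x y → adj x y ≡ adj y x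
open Graph public

V : Graph → Set
V G = Fin (n G)

Adj : (G : Graph) → V G → V G → Set
Adj G x y = adj G x y ≡ true

NbrColour : (G : Graph) {C : Set} → (V G → C) → V G → C → Set
NbrColour G r x c = Σ (V G) λ x' → Adj G x x' × r x' ≡ c

IsRoleColouring : (G : Graph) {C : Set} → (V G → C) → Set
IsRoleColouring G r =
  ∀ u v → r u ≡ r v → ∀ c → NbrColour G r u c ⇔ NbrColour G r v c

-- the role graph of r (vertex set = used colours, edges as in the
-- paper) is exactly H
RoleGraphIs : (G H : Graph) → (V G → V H) → Set
RoleGraphIs G H r =
  (∀ c → Σ (V G) λ x → r x ≡ c)
  × (∀ c d → Adj H c d ⇔ (Σ (V G) λ x → Σ (V G) λ y → Adj G x y × r x ≡ c × r y ≡ d))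

HRoleColouring : (H G : Graph) → Set
HRoleColouring H G =
  Σ (V G → V H) λ r → IsRoleColouring G r × RoleGraphIs G H r

-- Subdividing an edge {u,v} exactly p times.
-- Vertices of G' : Fin (n + p); via splitAt, inj₁ x = old vertex x,
-- inj₂ i = new vertex s_{i+1}.  Path u, s_1, ..., s_p, v.

module _ (G : Graph) (u v : V G) (p : ℕ) where
  private
    _=?_ : V G → V G → Bool
    x =? y = ⌊ x ≟F y ⌋

    isE : V G → V G → Bool
    isE x y = (x =? u ∧ y =? v) ∨ (x =? v ∧ y =? u)

    isE-sym : ∀ x y → isE x y ≡ isE y x
    isE-sym x y = trans (cong₂ _∨_ (∧-comm (x =? u) (y =? v)) (∧-comm (x =? v) (y =? u)))
                        (∨-comm (y =? v ∧ x =? u) (y =? u ∧ x =? v))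

    oldNew : V G → Fin p → Bool
    oldNew x i = (x =? u ∧ (toℕ i ≡ᵇ 0)) ∨ (x =? v ∧ (suc (toℕ i) ≡ᵇ p))

    newNew : Fin p → Fin p → Bool
    newNew i j = (suc (toℕ i) ≡ᵇ toℕ j) ∨ (suc (toℕ j) ≡ᵇ toℕ i)

    adjS : V G ⊎ Fin p → V G ⊎ Fin p → Bool
    adjS (inj₁ x) (inj₁ y) = adj G x y ∧ not (isE x y)
    adjS (inj₁ x) (inj₂ i) = oldNew x i
    adjS (inj₂ i) (inj₁ x) = oldNew x i
    adjS (inj₂ i) (inj₂ j) = newNew i j

    adjS-sym : ∀ a b → adjS a b ≡ adjS b a
    adjS-sym (inj₁ x) (inj₁ y) = cong₂ (λ s t → s ∧ not t) (sym G x y) (isE-sym x y)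
    adjS-sym (inj₁ x) (inj₂ i) = refl
    adjS-sym (inj₂ i) (inj₁ x) = refl
    adjS-sym (inj₂ i) (inj₂ j) = ∨-comm (suc (toℕ i) ≡ᵇ toℕ j) (suc (toℕ j) ≡ᵇ toℕ i)

  subdivide : Graph
  subdivide = record
    { n   = n G + p
    ; adj = λ a b → adjS (splitAt (n G) a) (splitAt (n G) b)
    ; sym = λ a b → adjS-sym (splitAt (n G) a) (splitAt (n G) b)
    }

-- The target graphs on vertices Fin k (paper vertex i ↦ Fin index i-1)

module _ (k : ℕ) where
  pathAdj : Fin k → Fin k → Bool
  pathAdj i j = (suc (toℕ i) ≡ᵇ toℕ j) ∨ (suc (toℕ j) ≡ᵇ toℕ i)

  pathAdj-sym : ∀ i j → pathAdj i j ≡ pathAdj j i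
  pathAdj-sym i j = ∨-comm (suc (toℕ i) ≡ᵇ toℕ j) (suc (toℕ j) ≡ᵇ toℕ i)

  wrap : Fin k → Fin k → Bool
  wrap i j = ((toℕ i ≡ᵇ 0) ∧ (toℕ j ≡ᵇ k ∸ 1)) ∨ ((toℕ j ≡ᵇ 0) ∧ (toℕ i ≡ᵇ k ∸ 1))

  wrap-sym : ∀ i j → wrap i j ≡ wrap j i
  wrap-sym i j = ∨-comm ((toℕ i ≡ᵇ 0) ∧ (toℕ j ≡ᵇ k ∸ 1)) ((toℕ j ≡ᵇ 0) ∧ (toℕ i ≡ᵇ k ∸ 1))

  loopEnd : Fin k → Fin k → Bool
  loopEnd i j = (toℕ i ≡ᵇ k ∸ 1) ∧ (toℕ j ≡ᵇ k ∸ 1)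

  loopEnd-sym : ∀ i j → loopEnd i j ≡ loopEnd j i
  loopEnd-sym i j = ∧-comm (toℕ i ≡ᵇ k ∸ 1) (toℕ j ≡ᵇ k ∸ 1)

  loopStart : Fin k → Fin k → Bool
  loopStart i j = (toℕ i ≡ᵇ 0) ∧ (toℕ j ≡ᵇ 0)

  loopStart-sym : ∀ i j → loopStart i j ≡ loopStart j i
  loopStart-sym i j = ∧-comm (toℕ i ≡ᵇ 0) (toℕ j ≡ᵇ 0)

  P : Graph
  P = record { n = k ; adj = pathAdj ; sym = pathAdj-sym }

  C : Graph
  C = record { n = k ; adj = λ i j → pathAdj i j ∨ wrap i j
             ; sym = λ i j → cong₂ _∨_ (pathAdj-sym i j) (wrap-sym i j) }

  P* : Graph
  P* = record { n = k ; adj = λ i j → pathAdj i j ∨ loopEnd i j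
              ; sym = λ i j → cong₂ _∨_ (pathAdj-sym i j) (loopEnd-sym i j) }

  P** : Graph
  P** = record { n = k ; adj = λ i j → (pathAdj i j ∨ loopStart i j) ∨ loopEnd i j
               ; sym = λ i j → cong₂ _∨_ (cong₂ _∨_ (pathAdj-sym i j) (loopStart-sym i j))
                                         (loopEnd-sym i j) }

data Pair : Set where
  cyc path path* path** : Pair

targetGraph : Pair → ℕ → Graph
targetGraph cyc    k = C k
targetGraph path   k = P k
targetGraph path*  k = P* k
targetGraph path** k = P** k

subdivCount : Pair → ℕ → ℕ
subdivCount cyc    k = k
subdivCount path   k = 2 * k ∸ 2
subdivCount path*  k = 2 * k ∸ 1
subdivCount path** k = 2 * k

-- An H-role colouring is a locally surjective homomorphism onto H: the colours
-- around x are exactly the neighbours of its colour.  On the new path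
-- u = s₀, s₁, …, s_p, s_{p+1} = v this says that the colours form a valid walk
-- in H (each inner colour has exactly the previous and next colour as
-- neighbours), and in any graph a valid walk is determined by its first two
-- terms.  Hence, if every edge ab of H starts a valid walk which is back at a, b
-- after p steps and H is connected, a colouring of G extends along such a walk,
-- and a colouring of G' restricts to G (the walk from r u returns, so s₁ and s_p
-- have the colours of v and u): this is the transfer theorem below.  Its
-- hypotheses follow from a closed walk of length p that covers H with exactly
-- the walk-neighbours as neighbours, by rotating or reversing it.

module Submission where

open import Defs renaming (sym to adj-sym)
open import Data.Bool using (Bool; true; false; _∧_; _∨_; not)
open import Data.Bool.Properties using (T-≡)
open import Data.Nat using (ℕ; zero; suc; _+_; _*_; _∸_; _%_; _≤_; _<_; _≡ᵇ_; s≤s; z≤n; _<?_)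
open import Data.Nat.Properties
  using (≡ᵇ⇒≡; ≡⇒≡ᵇ; <⇒≤; ≤-refl; ≤-trans; <-irrefl; <-trans; n<1+n; m≤n⇒m<n∨m≡n; +-∸-assoc; m+n∸n≡m;
         n∸n≡0; m∸n≤m; +-assoc; +-comm; +-identityʳ; ≤-pred; +-monoˡ-≤; +-monoʳ-<; ≤-antisym;
         m≤m+n; m<m+n; m≤n⇒m≤1+n; ∸-monoˡ-≤; m+n∸m≡n; m+[n∸m]≡n; ≰⇒>; +-suc; +-cancelˡ-<; n≤0⇒n≡0;
         m+n≡0⇒m≡0; m+n≡0⇒n≡0; n≤1+n; _≟_; _≤?_)
open import Data.Nat.DivMod using (m%n<n; m<n⇒m%n≡m; n%n≡0; [m+n]%n≡m%n; %-distribˡ-+; m%n%n≡m%n)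
open import Data.Fin using (Fin; toℕ; fromℕ; fromℕ<; splitAt; join; _↑ˡ_)
open import Data.Fin.Properties
  using (splitAt-↑ˡ; splitAt-join; join-splitAt; toℕ<n; toℕ-injective; toℕ-fromℕ; toℕ-fromℕ<; fromℕ<-toℕ)
  renaming (_≟_ to _≟F_)
open import Data.Sum using (_⊎_; inj₁; inj₂; swap)
open import Data.Sum.Function.Propositional using (_⊎-⇔_)
open import Data.Product using (Σ; _×_; _,_; proj₁; proj₂)
open import Data.Product.Function.NonDependent.Propositional using (_×-⇔_)
open import Data.Empty using (⊥-elim)
open import Relation.Nullary using (yes; no)
open import Relation.Nullary.Decidable using (⌊_⌋)
open import Relation.Binary.PropositionalEquality
  using (_≡_; refl; sym; trans; cong; subst; subst₂; module ≡-Reasoning)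
open import Function.Bundles using (_⇔_; mk⇔; Equivalence)
open import Function.Construct.Composition using (_⇔-∘_)
open import Function.Construct.Symmetry using (⇔-sym)
open import Function.Construct.Identity using (⇔-id)

open Equivalence

∨-true : ∀ a b → a ∨ b ≡ true ⇔ (a ≡ true ⊎ b ≡ true)
∨-true true  b = mk⇔ (λ _ → inj₁ refl) (λ _ → refl)
∨-true false b = mk⇔ inj₂ λ { (inj₁ ()) ; (inj₂ h) → h }

∧-true : ∀ a b → a ∧ b ≡ true ⇔ (a ≡ true × b ≡ true)
∧-true true  b = mk⇔ (refl ,_) proj₂
∧-true false b = mk⇔ (λ ()) (λ { (() , _) })

∨-⇔ : ∀ {a b} {A B : Set} → a ≡ true ⇔ A → b ≡ true ⇔ B → a ∨ b ≡ true ⇔ (A ⊎ B)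
∨-⇔ {a} {b} da db = (da ⊎-⇔ db) ⇔-∘ ∨-true a b

∧-⇔ : ∀ {a b} {A B : Set} → a ≡ true ⇔ A → b ≡ true ⇔ B → a ∧ b ≡ true ⇔ (A × B)
∧-⇔ {a} {b} da db = (da ×-⇔ db) ⇔-∘ ∧-true a b

≡ᵇ-true : ∀ m n → (m ≡ᵇ n) ≡ true ⇔ m ≡ n
≡ᵇ-true m n = mk⇔ (λ h → ≡ᵇ⇒≡ m n (from T-≡ h)) (λ e → to T-≡ (≡⇒≡ᵇ m n e))

≟-true : ∀ {k} (x y : Fin k) → ⌊ x ≟F y ⌋ ≡ true ⇔ x ≡ y
≟-true x y with x ≟F y
... | yes e = mk⇔ (λ _ → e) (λ _ → refl)
... | no ne = mk⇔ (λ ()) (λ e → ⊥-elim (ne e))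

⊎-swap : {A B : Set} → (A ⊎ B) ⇔ (B ⊎ A)
⊎-swap = mk⇔ swap swap

LocallySurjective : (G H : Graph) → (V G → V H) → Set
LocallySurjective G H r = ∀ x c → NbrColour G r x c ⇔ Adj H (r x) c

Onto : (G H : Graph) → (V G → V H) → Set
Onto G H r = ∀ c → Σ (V G) λ x → r x ≡ c

LSHom : (H G : Graph) → Set
LSHom H G = Σ (V G → V H) λ r → Onto G H r × LocallySurjective G H r

-- An H-role colouring is the same thing as a locally surjective homomorphism
-- onto H: the role condition makes the neighbour colours depend only on the
-- colour, and the role graph condition identifies them with H-neighbourhoods.
roleColouring⇔LSHom : (H G : Graph) → HRoleColouring H G ⇔ LSHom H G
roleColouring⇔LSHom H G = mk⇔ toLSHom fromLSHom
  where
    toLSHom : HRoleColouring H G → LSHom H G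
    toLSHom (r , role , onto , roleGraph) = r , onto , λ x d → mk⇔
      (λ { (x' , a , e) → from (roleGraph (r x) d) (x , x' , a , refl , e) })
      (λ h → let (x₁ , y₁ , a , e₁ , e₂) = to (roleGraph (r x) d) h
             in to (role x₁ x e₁ d) (y₁ , a , e₂))

    fromLSHom : LSHom H G → HRoleColouring H G
    fromLSHom (r , onto , loc) = r , role , onto , roleGraph
      where
        role : IsRoleColouring G r
        role x y e c = ⇔-sym (loc y c) ⇔-∘ subst (λ z → NbrColour G r x c ⇔ Adj H z c) e (loc x c)
        roleGraph : ∀ c d → Adj H c d ⇔ (Σ (V G) λ x → Σ (V G) λ y → Adj G x y × r x ≡ c × r y ≡ d)
        roleGraph c d = mk⇔
          (λ h → let (x , e) = onto c
                     (y , a , e') = from (loc x d) (subst (λ z → Adj H z d) (sym e) h)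
                 in x , y , a , e , e')
          (λ { (x , y , a , refl , e') → to (loc x d) (y , a , e') })

-- Connectedness, as an induction principle: a property of vertices that is
-- preserved along edges and holds somewhere holds everywhere.
Connected : Graph → Set₁
Connected H = ∀ (Q : V H → Set) → (∀ c d → Adj H c d → Q c → Q d) → ∀ c₀ c → Q c₀ → Q c

-- A locally surjective map into a connected graph is onto as soon as G is
-- non-empty, since its image is closed under H-adjacency.
locallySurjective-onto : ∀ {G H} (r : V G → V H) → Connected H → LocallySurjective G H r →
                         V G → Onto G H r
locallySurjective-onto {G} {H} r connected loc x₀ c =
  connected (λ c → Σ (V G) λ x → r x ≡ c) image-closed (r x₀) c (x₀ , refl)
  where
    image-closed : ∀ c d → Adj H c d → Σ (V G) (λ x → r x ≡ c) → Σ (V G) λ y → r y ≡ d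
    image-closed c d a (x , refl) = let (y , _ , e) = from (loc x d) a in y , e

firstFin : ∀ {p} → 0 < p → Σ (Fin p) λ i → toℕ i ≡ 0
firstFin {suc q} _ = Fin.zero , refl

lastFin : ∀ {p} → 0 < p → Σ (Fin p) λ i → suc (toℕ i) ≡ p
lastFin {suc q} _ = fromℕ q , cong suc (toℕ-fromℕ q)

-- The subdivided graph G' = subdivide G u v p.  Its vertices split into old
-- vertices (inj₁ x) and path vertices (inj₂ i, standing for s_{i+1}); the
-- adjacency on this view (private in Defs) is restated with its meaning.
module Subdivision (G : Graph) (u v : V G) (p : ℕ) where

  G' : Graph
  G' = subdivide G u v p

  S : Set
  S = V G ⊎ Fin p

  split : V G' → S
  split = splitAt (n G)

  _=?_ : V G → V G → Bool
  x =? y = ⌊ x ≟F y ⌋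

  isE : V G → V G → Bool
  isE x y = (x =? u ∧ y =? v) ∨ (x =? v ∧ y =? u)

  oldNew : V G → Fin p → Bool
  oldNew x i = (x =? u ∧ (toℕ i ≡ᵇ 0)) ∨ (x =? v ∧ (suc (toℕ i) ≡ᵇ p))

  newNew : Fin p → Fin p → Bool
  newNew i j = (suc (toℕ i) ≡ᵇ toℕ j) ∨ (suc (toℕ j) ≡ᵇ toℕ i)

  adjS : S → S → Bool
  adjS (inj₁ x) (inj₁ y) = adj G x y ∧ not (isE x y)
  adjS (inj₁ x) (inj₂ i) = oldNew x i
  adjS (inj₂ i) (inj₁ x) = oldNew x i
  adjS (inj₂ i) (inj₂ j) = newNew i j

  adj-split : ∀ a b → adj G' a b ≡ adjS (split a) (split b)
  adj-split a b with split a | split b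
  ... | inj₁ x | inj₁ y = refl
  ... | inj₁ x | inj₂ j = refl
  ... | inj₂ i | inj₁ y = refl
  ... | inj₂ i | inj₂ j = refl

  isE-true : ∀ x y → isE x y ≡ true ⇔ ((x ≡ u × y ≡ v) ⊎ (x ≡ v × y ≡ u))
  isE-true x y = ∨-⇔ (∧-⇔ (≟-true x u) (≟-true y v)) (∧-⇔ (≟-true x v) (≟-true y u))

  oldNew-true : ∀ x i → oldNew x i ≡ true ⇔ ((x ≡ u × toℕ i ≡ 0) ⊎ (x ≡ v × suc (toℕ i) ≡ p))
  oldNew-true x i = ∨-⇔ (∧-⇔ (≟-true x u) (≡ᵇ-true _ 0)) (∧-⇔ (≟-true x v) (≡ᵇ-true _ p))

  newNew-true : ∀ i j → newNew i j ≡ true ⇔ (suc (toℕ i) ≡ toℕ j ⊎ suc (toℕ j) ≡ toℕ i)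
  newNew-true i j = ∨-⇔ (≡ᵇ-true _ _) (≡ᵇ-true _ _)

  module Colouring {Col : Set} (R : S → Col) where

    NbrColourS : S → Col → Set
    NbrColourS s d = Σ S λ t → adjS s t ≡ true × R t ≡ d

    nbrColour-split : (r' : V G' → Col) → (∀ a → r' a ≡ R (split a)) →
                      ∀ a d → NbrColour G' r' a d ⇔ NbrColourS (split a) d
    nbrColour-split r' r'≡R a d = mk⇔
      (λ { (a' , aa' , e) → split a' , trans (sym (adj-split a a')) aa' , trans (sym (r'≡R a')) e })
      (λ { (t , at , e) → join (n G) p t ,
             trans (adj-split a _) (subst (λ z → adjS (split a) z ≡ true) (sym (splitAt-join (n G) p t)) at) ,
             trans (r'≡R _) (trans (cong R (splitAt-join (n G) p t)) e) })

    -- If s₁ has the colour of v and s_p the colour of u, every old vertex sees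
    -- the same colours in G' as in G: the path stands in for the edge uv.
    module OldVertices (auv : Adj G u v) (p>0 : 0 < p)
                       (first : ∀ i → toℕ i ≡ 0 → R (inj₂ i) ≡ R (inj₁ v))
                       (last : ∀ i → suc (toℕ i) ≡ p → R (inj₂ i) ≡ R (inj₁ u)) where

      s₁ : Fin p
      s₁ = proj₁ (firstFin p>0)
      s₁-first : toℕ s₁ ≡ 0
      s₁-first = proj₂ (firstFin p>0)
      s-p : Fin p
      s-p = proj₁ (lastFin p>0)
      s-p-last : suc (toℕ s-p) ≡ p
      s-p-last = proj₂ (lastFin p>0)

      old-to : ∀ x d → NbrColour G (λ z → R (inj₁ z)) x d → NbrColourS (inj₁ x) d
      old-to x d (y , axy , e) with isE x y in removed
      ... | false = inj₁ y , from (∧-true _ _) (axy , cong not removed) , e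
      ... | true with to (isE-true x y) removed
      ...   | inj₁ (refl , refl) = inj₂ s₁ , from (oldNew-true x s₁) (inj₁ (refl , s₁-first)) ,
                                   trans (first s₁ s₁-first) e
      ...   | inj₂ (refl , refl) = inj₂ s-p , from (oldNew-true x s-p) (inj₂ (refl , s-p-last)) ,
                                   trans (last s-p s-p-last) e

      old-from : ∀ x d → NbrColourS (inj₁ x) d → NbrColour G (λ z → R (inj₁ z)) x d
      old-from x d (inj₁ y , axy , e) = y , proj₁ (to (∧-true _ _) axy) , e
      old-from x d (inj₂ i , axi , e) with to (oldNew-true x i) axi
      ... | inj₁ (refl , i-first) = v , auv , trans (sym (first i i-first)) e
      ... | inj₂ (refl , i-last) = u , trans (adj-sym G v u) auv , trans (sym (last i i-last)) e

      nbrColour-old : ∀ x d → NbrColour G (λ z → R (inj₁ z)) x d ⇔ NbrColourS (inj₁ x) d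
      nbrColour-old x d = mk⇔ (old-to x d) (old-from x d)

    module PathVertices (g : ℕ → Col) (g-u : g 0 ≡ R (inj₁ u)) (g-v : g (suc p) ≡ R (inj₁ v))
                        (g-s : ∀ i → g (suc (toℕ i)) ≡ R (inj₂ i)) where

      path-to : ∀ i d → NbrColourS (inj₂ i) d → d ≡ g (toℕ i) ⊎ d ≡ g (suc (suc (toℕ i)))
      path-to i d (inj₁ x , axi , e) with to (oldNew-true x i) axi
      ... | inj₁ (refl , i-first) = inj₁ (trans (sym e) (trans (sym g-u) (cong g (sym i-first))))
      ... | inj₂ (refl , i-last) = inj₂ (trans (sym e) (trans (sym g-v) (cong (λ z → g (suc z)) (sym i-last))))
      path-to i d (inj₂ j , aij , e) with to (newNew-true i j) aij
      ... | inj₁ j≡i+1 = inj₂ (trans (sym e) (trans (sym (g-s j)) (cong (λ z → g (suc z)) (sym j≡i+1))))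
      ... | inj₂ i≡j+1 = inj₁ (trans (sym e) (trans (sym (g-s j)) (cong g i≡j+1)))

      path-from-pred : ∀ i d → d ≡ g (toℕ i) → NbrColourS (inj₂ i) d
      path-from-pred i d e with toℕ i in i≡
      ... | zero = inj₁ u , from (oldNew-true u i) (inj₁ (refl , i≡)) , trans (sym g-u) (sym e)
      ... | suc j = inj₂ t , from (newNew-true i t) (inj₂ (trans (cong suc t≡j) (sym i≡))) ,
                    trans (sym (g-s t)) (trans (cong (λ z → g (suc z)) t≡j) (sym e))
        where
          j<p : j < p
          j<p = <-trans (n<1+n j) (subst (_< p) i≡ (toℕ<n i))
          t : Fin p
          t = fromℕ< j<p
          t≡j : toℕ t ≡ j
          t≡j = toℕ-fromℕ< j<p

      path-from-succ : ∀ i d → d ≡ g (suc (suc (toℕ i))) → NbrColourS (inj₂ i) d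
      path-from-succ i d e with m≤n⇒m<n∨m≡n (toℕ<n i)
      ... | inj₁ i+1<p = inj₂ (fromℕ< i+1<p) , from (newNew-true i _) (inj₁ (sym (toℕ-fromℕ< i+1<p))) ,
                         trans (sym (g-s _)) (trans (cong (λ z → g (suc z)) (toℕ-fromℕ< i+1<p)) (sym e))
      ... | inj₂ i+1≡p = inj₁ v , from (oldNew-true v i) (inj₂ (refl , i+1≡p)) ,
                         trans (sym g-v) (trans (cong (λ z → g (suc z)) (sym i+1≡p)) (sym e))

      nbrColour-path : ∀ i d → NbrColourS (inj₂ i) d ⇔ (d ≡ g (toℕ i) ⊎ d ≡ g (suc (suc (toℕ i))))
      nbrColour-path i d = mk⇔ (path-to i d)
        λ { (inj₁ e) → path-from-pred i d e ; (inj₂ e) → path-from-succ i d e }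

    pathColour : ℕ → Col
    pathColour zero = R (inj₁ u)
    pathColour (suc j) with j <? p
    ... | yes j<p = R (inj₂ (fromℕ< j<p))
    ... | no _ = R (inj₁ v)

    pathColour-v : pathColour (suc p) ≡ R (inj₁ v)
    pathColour-v with p <? p
    ... | yes p<p = ⊥-elim (<-irrefl refl p<p)
    ... | no _ = refl

    pathColour-s : ∀ i → pathColour (suc (toℕ i)) ≡ R (inj₂ i)
    pathColour-s i with toℕ i <? p
    ... | yes i<p = cong (λ z → R (inj₂ z)) (fromℕ<-toℕ i i<p)
    ... | no i≮p = ⊥-elim (i≮p (toℕ<n i))

∸-step : ∀ {j t} → j < t → t ∸ j ≡ suc (t ∸ suc j)
∸-step j<t = +-∸-assoc 1 j<t

-- These are
-- the colour sequences along the subdivision path of a locally surjective map.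
ValidWalk : (H : Graph) → ℕ → (ℕ → V H) → Set
ValidWalk H p f = ∀ j → j < p → ∀ d → Adj H (f (suc j)) d ⇔ (d ≡ f j ⊎ d ≡ f (suc (suc j)))

ReturningWalk : (H : Graph) → ℕ → V H → V H → Set
ReturningWalk H p a b =
  Σ (ℕ → V H) λ f → ValidWalk H p f × f 0 ≡ a × f 1 ≡ b × f p ≡ a × f (suc p) ≡ b

module _ {H : Graph} where

  third-determined : ∀ {a b c c'} → (∀ d → Adj H b d ⇔ (d ≡ a ⊎ d ≡ c)) →
                     (∀ d → Adj H b d ⇔ (d ≡ a ⊎ d ≡ c')) → c ≡ c'
  third-determined {c = c} {c'} N N' with to (N' c) (from (N c) (inj₂ refl))
  ... | inj₂ c≡c' = c≡c'
  ... | inj₁ c≡a with to (N c') (from (N' c') (inj₂ refl))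
  ...   | inj₁ c'≡a = trans c≡a (sym c'≡a)
  ...   | inj₂ c'≡c = sym c'≡c

  walk-unique : ∀ {p f g} → ValidWalk H p f → ValidWalk H p g → f 0 ≡ g 0 → f 1 ≡ g 1 →
                ∀ j → j ≤ p → f j ≡ g j × f (suc j) ≡ g (suc j)
  walk-unique vf vg e₀ e₁ zero _ = e₀ , e₁
  walk-unique {g = g} vf vg e₀ e₁ (suc j) j<p with walk-unique vf vg e₀ e₁ j (<⇒≤ j<p)
  ... | (eʲ , eʲ⁺¹) = eʲ⁺¹ , third-determined (vf j j<p) Ng
    where
      Ng : ∀ d → Adj H _ d ⇔ (d ≡ _ ⊎ d ≡ g (suc (suc j)))
      Ng = subst₂ (λ b a → ∀ d → Adj H b d ⇔ (d ≡ a ⊎ d ≡ g (suc (suc j)))) (sym eʲ⁺¹) (sym eʲ) (vg j j<p)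

  walk-reverse : ∀ {p f} → ValidWalk H p f → ValidWalk H p (λ t → f (suc p ∸ t))
  walk-reverse {p} {f} vf j j<p d =
    subst₂ (λ b c → Adj H (f b) d ⇔ (d ≡ c ⊎ d ≡ f (p ∸ suc j))) (sym p∸j) (cong f (sym p+1∸j))
           (⊎-swap ⇔-∘ vf (p ∸ suc j) i<p d)
    where
      p∸j : p ∸ j ≡ suc (p ∸ suc j)
      p∸j = ∸-step j<p
      p+1∸j : suc p ∸ j ≡ suc (suc (p ∸ suc j))
      p+1∸j = trans (+-∸-assoc 1 (<⇒≤ j<p)) (cong suc p∸j)
      i<p : p ∸ suc j < p
      i<p = subst (_≤ p) p∸j (m∸n≤m p j)

  reverse-returning : ∀ {p a b} → ReturningWalk H p a b → ReturningWalk H p b a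
  reverse-returning {p} (f , vf , f₀ , f₁ , fₚ , fₚ₊₁) =
    (λ t → f (suc p ∸ t)) , walk-reverse vf , fₚ₊₁ , fₚ ,
    trans (cong f (m+n∸n≡m 1 p)) f₁ , trans (cong f (n∸n≡0 p)) f₀

  walk-returns : ∀ {p f} → (∀ a b → Adj H a b → ReturningWalk H p a b) → 0 < p →
                 ValidWalk H p f → f p ≡ f 0 × f (suc p) ≡ f 1
  walk-returns {p} {f} walks p>0 vf =
    let (g , vg , g₀ , g₁ , gₚ , gₚ₊₁) = walks (f 0) (f 1) f₀f₁
        (fₚ , fₚ₊₁) = walk-unique vf vg (sym g₀) (sym g₁) p ≤-refl
    in trans fₚ gₚ , trans fₚ₊₁ gₚ₊₁
    where
      f₀f₁ : Adj H (f 0) (f 1)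
      f₀f₁ = trans (adj-sym H (f 0) (f 1)) (from (vf 0 p>0 (f 0)) (inj₁ refl))

SubdivisionInvariant : Graph → ℕ → Set
SubdivisionInvariant H p = (G : Graph) (u v : V G) → Adj G u v →
                           HRoleColouring H G ⇔ HRoleColouring H (subdivide G u v p)

module Transfer (H : Graph) (p : ℕ) (p>0 : 0 < p)
                (walks : ∀ a b → Adj H a b → ReturningWalk H p a b) (connected : Connected H)
                (G : Graph) (u v : V G) (auv : Adj G u v) where
  open Subdivision G u v p

  -- (⇒) Colour the new path along the returning walk that starts with r u, r v.
  extend : LSHom H G → LSHom H G'
  extend (r , onto , loc) = extendAlong (walks (r u) (r v) (to (loc u (r v)) (v , auv , refl)))
    where
      extendAlong : ReturningWalk H p (r u) (r v) → LSHom H G'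
      extendAlong (f , vf , f₀ , f₁ , fₚ , fₚ₊₁) = r' , onto' , loc'
        where
          R : S → V H
          R (inj₁ x) = r x
          R (inj₂ i) = f (suc (toℕ i))
          open Colouring R
          open PathVertices f f₀ fₚ₊₁ (λ _ → refl)
          open OldVertices auv p>0 (λ _ e → trans (cong (λ z → f (suc z)) e) f₁) (λ _ e → trans (cong f e) fₚ)
          locS : ∀ s d → NbrColourS s d ⇔ Adj H (R s) d
          locS (inj₁ x) d = loc x d ⇔-∘ ⇔-sym (nbrColour-old x d)
          locS (inj₂ i) d = ⇔-sym (vf (toℕ i) (toℕ<n i) d) ⇔-∘ nbrColour-path i d
          r' : V G' → V H
          r' a = R (split a)
          loc' : LocallySurjective G' H r'
          loc' a d = locS (split a) d ⇔-∘ nbrColour-split r' (λ _ → refl) a d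
          onto' : Onto G' H r'
          onto' c = let (x , e) = onto c in x ↑ˡ p , trans (cong R (splitAt-↑ˡ (n G) x p)) e

  -- (⇐) Restrict to the old vertices.  The colours along the path form a valid
  -- walk, which returns; so s₁ has the colour of v and s_p that of u.
  restrict : LSHom H G' → LSHom H G
  restrict (r' , _ , loc') = r , locallySurjective-onto {G} {H} r connected loc u , loc
    where
      R : S → V H
      R s = r' (join (n G) p s)
      r'≡R : ∀ a → r' a ≡ R (split a)
      r'≡R a = cong r' (sym (join-splitAt (n G) p a))
      open Colouring R
      locS : ∀ s d → NbrColourS s d ⇔ Adj H (R s) d
      locS s d = subst (λ z → NbrColourS z d ⇔ Adj H (R s) d) (splitAt-join (n G) p s)
                       (loc' (join (n G) p s) d ⇔-∘ ⇔-sym (nbrColour-split r' r'≡R (join (n G) p s) d))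
      open PathVertices pathColour refl pathColour-v pathColour-s
      valid : ValidWalk H p pathColour
      valid j j<p d = subst (λ t → Adj H (pathColour (suc t)) d ⇔ (d ≡ pathColour t ⊎ d ≡ pathColour (suc (suc t))))
                            (toℕ-fromℕ< j<p) (nbrColour-path i d ⇔-∘ adjacent)
        where
          i = fromℕ< j<p
          adjacent : Adj H (pathColour (suc (toℕ i))) d ⇔ NbrColourS (inj₂ i) d
          adjacent = subst (λ c → Adj H c d ⇔ NbrColourS (inj₂ i) d) (sym (pathColour-s i)) (⇔-sym (locS (inj₂ i) d))
      returns : pathColour p ≡ pathColour 0 × pathColour (suc p) ≡ pathColour 1
      returns = walk-returns {H} walks p>0 valid
      open OldVertices auv p>0
        (λ i e → trans (sym (pathColour-s i)) (trans (cong (λ z → pathColour (suc z)) e)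
                                                     (trans (sym (proj₂ returns)) pathColour-v)))
        (λ i e → trans (sym (pathColour-s i)) (trans (cong pathColour e) (proj₁ returns)))
      r : V G → V H
      r x = R (inj₁ x)
      loc : LocallySurjective G H r
      loc x d = locS (inj₁ x) d ⇔-∘ nbrColour-old x d

transfer : (H : Graph) (p : ℕ) → 0 < p → (∀ a b → Adj H a b → ReturningWalk H p a b) → Connected H →
           SubdivisionInvariant H p
transfer H p p>0 walks connected G u v auv =
  ⇔-sym (roleColouring⇔LSHom H (subdivide G u v p))
    ⇔-∘ (mk⇔ extend restrict ⇔-∘ roleColouring⇔LSHom H G)
  where open Transfer H p p>0 walks connected G u v auv

-- Positions on the cycle C_L, L = L' + 2, represented by 0, …, L-1.
module CyclicPositions (L' : ℕ) where

  L : ℕ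
  L = suc (suc L')

  next : ℕ → ℕ
  next y = suc y % L

  prev : ℕ → ℕ
  prev zero = suc L'
  prev (suc y) = y

  next-below : ∀ y → suc y < L → next y ≡ suc y
  next-below y y+1<L = m<n⇒m%n≡m y+1<L

  next-last : next (suc L') ≡ 0
  next-last = n%n≡0 L

  next< : ∀ y → next y < L
  next< y = m%n<n (suc y) L

  prev< : ∀ y → y < L → prev y < L
  prev< zero _ = ≤-refl
  prev< (suc y) y<L = <-trans (n<1+n y) y<L

  prev-next : ∀ y → y < L → prev (next y) ≡ y
  prev-next y y<L with m≤n⇒m<n∨m≡n y<L
  ... | inj₁ y+1<L = cong prev (next-below y y+1<L)
  ... | inj₂ refl = cong prev next-last

  next-prev : ∀ y → y < L → next (prev y) ≡ y
  next-prev zero _ = next-last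
  next-prev (suc y) y<L = next-below y y<L

  next-% : ∀ x → next (x % L) ≡ suc x % L
  next-% x = begin
      (1 + x % L) % L          ≡⟨ %-distribˡ-+ 1 (x % L) L ⟩
      (1 % L + x % L % L) % L  ≡⟨ cong (λ z → (1 % L + z) % L) (m%n%n≡m%n x L) ⟩
      (1 % L + x % L) % L      ≡⟨ sym (%-distribˡ-+ 1 x L) ⟩
      (1 + x) % L              ∎
    where open ≡-Reasoning

  -- A closed-walk cover of H of length L: φ 0, …, φ (L-1) is a closed walk
  -- visiting every vertex of H such that the neighbours of φ y are exactly
  -- φ (prev y) and φ (next y).  (Equivalently, φ is an H-role colouring of C_L.)
  -- Such a cover yields the hypotheses of the transfer theorem for p = L.
  module Cover (H : Graph) (φ : ℕ → V H)
               (nbr : ∀ y → y < L → ∀ d → Adj H (φ y) d ⇔ (d ≡ φ (prev y) ⊎ d ≡ φ (next y)))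
               (onto : ∀ c → Σ ℕ λ y → y < L × φ y ≡ c) where

    rotation : ℕ → ℕ → V H
    rotation z t = φ ((t + z) % L)

    position-suc : ∀ z t → (suc t + z) % L ≡ next ((t + z) % L)
    position-suc z t = sym (next-% (t + z))

    rotation-valid : ∀ z t d → Adj H (rotation z (suc t)) d ⇔ (d ≡ rotation z t ⊎ d ≡ rotation z (suc (suc t)))
    rotation-valid z t d =
      subst₂ (λ b c → Adj H (φ b) d ⇔ (d ≡ rotation z t ⊎ d ≡ φ c)) (sym (position-suc z t))
             (sym (trans (position-suc z (suc t)) (cong next (position-suc z t)))) around
      where
        w = (t + z) % L
        around : Adj H (φ (next w)) d ⇔ (d ≡ φ w ⊎ d ≡ φ (next (next w)))
        around = subst (λ q → Adj H (φ (next w)) d ⇔ (d ≡ φ q ⊎ d ≡ φ (next (next w))))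
                       (prev-next w (m%n<n (t + z) L)) (nbr (next w) (next< w) d)

    rotation-period : ∀ z t → rotation z (t + L) ≡ rotation z t
    rotation-period z t = cong φ (begin
        (t + L + z) % L    ≡⟨ cong (_% L) (+-assoc t L z) ⟩
        (t + (L + z)) % L  ≡⟨ cong (λ q → (t + q) % L) (+-comm L z) ⟩
        (t + (z + L)) % L  ≡⟨ cong (_% L) (sym (+-assoc t z L)) ⟩
        (t + z + L) % L    ≡⟨ [m+n]%n≡m%n (t + z) L ⟩
        (t + z) % L        ∎)
      where open ≡-Reasoning

    rotation-start : ∀ z → z < L → rotation z 0 ≡ φ z
    rotation-start z z<L = cong φ (m<n⇒m%n≡m z<L)

    rotation-returning : ∀ z → z < L → ReturningWalk H L (φ z) (φ (next z))
    rotation-returning z z<L =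
      rotation z , (λ j _ → rotation-valid z j) , rotation-start z z<L , refl ,
      trans (rotation-period z 0) (rotation-start z z<L) , rotation-period z 1

    -- every edge of H is traversed by the cover, in one direction or the other
    walks : ∀ a b → Adj H a b → ReturningWalk H L a b
    walks a b ab with onto a
    ... | (y , y<L , refl) with to (nbr y y<L b) ab
    ...   | inj₂ refl = rotation-returning y y<L
    ...   | inj₁ refl = reverse-returning {H}
                          (subst (ReturningWalk H L (φ (prev y))) (cong φ (next-prev y y<L))
                                 (rotation-returning (prev y) (prev< y y<L)))

    connected : Connected H
    connected Q closed c₀ c q₀ with onto c₀ | onto c
    ... | (y₀ , y₀<L , refl) | (y , y<L , refl) =
      subst Q (at y y<L) (up y (down y₀ (subst Q (sym (at y₀ y₀<L)) q₀)))
      where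
        at : ∀ y → y < L → rotation 0 y ≡ φ y
        at y y<L = cong φ (trans (cong (_% L) (+-identityʳ y)) (m<n⇒m%n≡m y<L))
        back-adj : ∀ t → Adj H (rotation 0 (suc t)) (rotation 0 t)
        back-adj t = from (rotation-valid 0 t _) (inj₁ refl)
        down : ∀ t → Q (rotation 0 t) → Q (rotation 0 0)
        down zero q = q
        down (suc t) q = down t (closed _ _ (back-adj t) q)
        up : ∀ t → Q (rotation 0 0) → Q (rotation 0 t)
        up zero q = q
        up (suc t) q = closed _ _ (trans (adj-sym H _ _) (back-adj t)) (up t q)

    cover-invariance : SubdivisionInvariant H L
    cover-invariance = transfer H L (s≤s z≤n) walks connected

-- Covers of a graph on Fin k, k = m + 2, described by arithmetic on ℕ: the
-- neighbours of vertex x are the two "slots" n₁ x and n₂ x, and the cover visits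
-- vertex fold y at position y.  The cover condition then says that the slots of
-- fold y are filled, in some order, by the folds of the two adjacent positions.
module FoldedCover (m L' : ℕ) where
  open CyclicPositions L' public

  k : ℕ
  k = suc (suc m)

  toFin : ℕ → Fin k
  toFin x = fromℕ< (m%n<n x k)

  toℕ-toFin : ∀ x → x < k → toℕ (toFin x) ≡ x
  toℕ-toFin x x<k = trans (toℕ-fromℕ< (m%n<n x k)) (m<n⇒m%n≡m x<k)

  SlotsMatch : (n₁ n₂ fold : ℕ → ℕ) → ℕ → Set
  SlotsMatch n₁ n₂ fold y = (n₁ (fold y) ≡ fold (prev y) × n₂ (fold y) ≡ fold (next y))
                    ⊎ (n₁ (fold y) ≡ fold (next y) × n₂ (fold y) ≡ fold (prev y))

  module Folding (k≤L : k ≤ L) (A : Fin k → Fin k → Set) (n₁ n₂ : ℕ → ℕ)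
           (slots : ∀ i j → A i j ⇔ (toℕ j ≡ n₁ (toℕ i) ⊎ toℕ j ≡ n₂ (toℕ i)))
           (fold : ℕ → ℕ) (fold< : ∀ y → y < L → fold y < k) (fold-id : ∀ x → x < k → fold x ≡ x) where

    φ : ℕ → Fin k
    φ y = toFin (fold y)

    toℕ-φ : ∀ y → y < L → toℕ (φ y) ≡ fold y
    toℕ-φ y y<L = toℕ-toFin (fold y) (fold< y y<L)

    at-position : ∀ y → y < L → (d : Fin k) → (d ≡ φ y) ⇔ (toℕ d ≡ fold y)
    at-position y y<L d = mk⇔ (λ { refl → toℕ-φ y y<L }) (λ e → toℕ-injective (trans e (sym (toℕ-φ y y<L))))

    φ-nbr : (∀ y → y < L → SlotsMatch n₁ n₂ fold y) →
            ∀ y → y < L → ∀ d → A (φ y) d ⇔ (d ≡ φ (prev y) ⊎ d ≡ φ (next y))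
    φ-nbr good y y<L d =
      ⇔-sym (at-position (prev y) (prev< y y<L) d ⊎-⇔ at-position (next y) (next< y) d)
        ⇔-∘ (filled (good y y<L) ⇔-∘ slots-at-y)
      where
        slots-at-y : A (φ y) d ⇔ (toℕ d ≡ n₁ (fold y) ⊎ toℕ d ≡ n₂ (fold y))
        slots-at-y = subst (λ x → A (φ y) d ⇔ (toℕ d ≡ n₁ x ⊎ toℕ d ≡ n₂ x)) (toℕ-φ y y<L) (slots (φ y) d)
        filled : SlotsMatch n₁ n₂ fold y →
                 (toℕ d ≡ n₁ (fold y) ⊎ toℕ d ≡ n₂ (fold y)) ⇔ (toℕ d ≡ fold (prev y) ⊎ toℕ d ≡ fold (next y))
        filled (inj₁ (e₁ , e₂)) rewrite e₁ | e₂ = ⇔-id _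
        filled (inj₂ (e₁ , e₂)) rewrite e₁ | e₂ = ⊎-swap

    φ-onto : ∀ c → Σ ℕ λ y → y < L × φ y ≡ c
    φ-onto c = toℕ c , ≤-trans (toℕ<n c) k≤L ,
               toℕ-injective (trans (toℕ-φ (toℕ c) (≤-trans (toℕ<n c) k≤L)) (fold-id (toℕ c) (toℕ<n c)))

-- C_k is covered by going once around it: L = k, the fold is the identity and
-- the slots of x are its cyclic predecessor and successor.
module CycleCover (m : ℕ) where
  open FoldedCover m m

  CycleAdj : ℕ → ℕ → Set
  CycleAdj x z = (suc x ≡ z ⊎ suc z ≡ x) ⊎ ((x ≡ 0 × z ≡ suc m) ⊎ (z ≡ 0 × x ≡ suc m))

  decode : ∀ i j → Adj (C k) i j ⇔ CycleAdj (toℕ i) (toℕ j)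
  decode i j = ∨-⇔ (∨-⇔ (≡ᵇ-true _ _) (≡ᵇ-true _ _))
                   (∨-⇔ (∧-⇔ (≡ᵇ-true _ _) (≡ᵇ-true _ _)) (∧-⇔ (≡ᵇ-true _ _) (≡ᵇ-true _ _)))

  adj-prev : ∀ x → CycleAdj x (prev x)
  adj-prev zero = inj₂ (inj₁ (refl , refl))
  adj-prev (suc x) = inj₁ (inj₂ refl)

  adj-next : ∀ x → x < L → CycleAdj x (next x)
  adj-next x x<L with m≤n⇒m<n∨m≡n x<L
  ... | inj₁ x+1<L = inj₁ (inj₁ (sym (next-below x x+1<L)))
  ... | inj₂ refl = inj₂ (inj₂ (next-last , refl))

  cyclic-slots : ∀ x z → x < L → z < L → CycleAdj x z ⇔ (z ≡ prev x ⊎ z ≡ next x)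
  cyclic-slots x z x<L z<L = mk⇔ slot (λ { (inj₁ refl) → adj-prev x ; (inj₂ refl) → adj-next x x<L })
    where
      slot : CycleAdj x z → z ≡ prev x ⊎ z ≡ next x
      slot (inj₁ (inj₁ refl)) = inj₂ (sym (next-below x z<L))
      slot (inj₁ (inj₂ refl)) = inj₁ refl
      slot (inj₂ (inj₁ (refl , refl))) = inj₁ refl
      slot (inj₂ (inj₂ (refl , refl))) = inj₂ (sym next-last)

  slots : ∀ i j → Adj (C k) i j ⇔ (toℕ j ≡ prev (toℕ i) ⊎ toℕ j ≡ next (toℕ i))
  slots i j = cyclic-slots (toℕ i) (toℕ j) (toℕ<n i) (toℕ<n j) ⇔-∘ decode i j

  open Folding ≤-refl (Adj (C k)) prev next slots (λ y → y) (λ _ y<L → y<L) (λ _ _ → refl)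

  cycle-invariance : SubdivisionInvariant (C k) k
  cycle-invariance = Cover.cover-invariance (C k) φ (φ-nbr (λ _ _ → inj₁ (refl , refl))) φ-onto

-- Arithmetic facts for the descending half of the path covers (a ≤ 1 below is
-- the number of loops at vertex 0).
zero-or-suc : ∀ n → n ≡ 0 ⊎ Σ ℕ λ e → n ≡ suc e
zero-or-suc zero = inj₁ refl
zero-or-suc (suc e) = inj₂ (e , refl)

+-zeroʳ-at : ∀ {m n} → n ≡ 0 → m + n ≡ m
+-zeroʳ-at {m} refl = +-identityʳ m

below-top : ∀ {a j t} → a ≤ 1 → j < a + t → j ≤ t
below-top {t = t} a≤1 j<a+t = ≤-pred (≤-trans j<a+t (+-monoˡ-≤ t a≤1))

bottom-value : ∀ {a t e} → a ≤ 1 → a + t ≡ suc e → t ∸ e ≡ 1 ∸ a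
bottom-value {e = e} z≤n refl = m+n∸n≡m 1 e
bottom-value {t = t} (s≤s z≤n) refl = n∸n≡0 t

-- The paths P_k, P_k*, P_k** (k = m + 2, vertices 0 … m+1) are covered by a walk
-- that climbs 0, 1, …, m+1, continues with t (t = m, or t = m+1 when m+1 has a
-- loop) and descends t, t-1, …, down to 1 (a = 0) or to 0 (a = 1, a loop at 0).
-- Its length is L = k + a + t.  Every vertex has two neighbour slots: n₁
-- downwards (1 ∸ a at vertex 0) and n₂ upwards (t at vertex m+1).
module PathCover (m t a : ℕ) (m≤t : m ≤ t) (t≤1+m : t ≤ suc m) (a≤1 : a ≤ 1) where
  open FoldedCover m (m + (a + t)) public
  open ≡-Reasoning

  n₁ : ℕ → ℕ
  n₁ zero = 1 ∸ a
  n₁ (suc x) = x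

  n₂ : ℕ → ℕ
  n₂ x with x ≟ suc m
  ... | yes _ = t
  ... | no _ = suc x

  n₂-top : n₂ (suc m) ≡ t
  n₂-top with suc m ≟ suc m
  ... | yes _ = refl
  ... | no ≢ = ⊥-elim (≢ refl)

  n₂-below : ∀ x → x ≤ m → n₂ x ≡ suc x
  n₂-below x x≤m with x ≟ suc m
  ... | yes refl = ⊥-elim (<-irrefl refl x≤m)
  ... | no _ = refl

  n₂-t : n₂ t ≡ suc m
  n₂-t with m≤n⇒m<n∨m≡n t≤1+m
  ... | inj₁ t≤m = trans (cong n₂ (≤-antisym (≤-pred t≤m) m≤t)) (n₂-below m ≤-refl)
  ... | inj₂ refl = n₂-top

  n₁-bottom : n₁ (1 ∸ a) ≡ 0
  n₁-bottom with 1 ∸ a in eq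
  ... | zero = eq
  ... | suc zero = refl
  ... | suc (suc _) with subst (_≤ 1) eq (m∸n≤m 1 a)
  ...   | s≤s ()

  slot₁ : ∀ x z → z ≡ n₁ x → (x ≡ 0 × z ≡ 1 ∸ a) ⊎ suc z ≡ x
  slot₁ zero z e = inj₁ (refl , e)
  slot₁ (suc x) z e = inj₂ (cong suc e)

  slot₂ : ∀ x z → z ≡ n₂ x → (x ≡ suc m × z ≡ t) ⊎ suc x ≡ z
  slot₂ x z e with x ≟ suc m
  ... | yes x≡ = inj₁ (x≡ , e)
  ... | no _ = inj₂ (sym e)

  down-slot : ∀ x z → suc z ≡ x → z ≡ n₁ x
  down-slot _ z refl = refl

  up-slot : ∀ x z → z < k → suc x ≡ z → z ≡ n₂ x
  up-slot x _ z<k refl = sym (n₂-below x (≤-pred (≤-pred z<k)))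

  Step : ℕ → ℕ → Set
  Step x z = suc x ≡ z ⊎ suc z ≡ x

  step-slot : ∀ x z → z < k → Step x z → z ≡ n₁ x ⊎ z ≡ n₂ x
  step-slot x z z<k (inj₁ e) = inj₂ (up-slot x z z<k e)
  step-slot x z _ (inj₂ e) = inj₁ (down-slot x z e)

  fold : ℕ → ℕ
  fold y with y ≤? suc m
  ... | yes _ = y
  ... | no _ = t ∸ (y ∸ k)

  fold-up : ∀ x → x ≤ suc m → fold x ≡ x
  fold-up x x≤ with x ≤? suc m
  ... | yes _ = refl
  ... | no x≰ = ⊥-elim (x≰ x≤)

  fold-down : ∀ j → fold (k + j) ≡ t ∸ j
  fold-down j with k + j ≤? suc m
  ... | yes k+j≤ = ⊥-elim (<-irrefl refl (≤-trans (m≤m+n k j) k+j≤))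
  ... | no _ = cong (t ∸_) (m+n∸m≡n k j)

  fold-top : fold k ≡ t
  fold-top = trans (cong fold (sym (+-identityʳ k))) (fold-down 0)

  fold< : ∀ y → y < L → fold y < k
  fold< y _ with y ≤? suc m
  ... | yes y≤ = s≤s y≤
  ... | no _ = s≤s (≤-trans (m∸n≤m t (y ∸ k)) t≤1+m)

  fold-id : ∀ x → x < k → fold x ≡ x
  fold-id x x<k = fold-up x (≤-pred x<k)

  k≤L : k ≤ L
  k≤L = m≤m+n k (a + t)

  data Position : ℕ → Set where
    start : Position 0
    ascending : ∀ x → x ≤ m → Position (suc x)
    descending : ∀ j → Position (k + j)

  position : ∀ y → Position y
  position zero = start
  position (suc x) with x ≤? m
  ... | yes x≤m = ascending x x≤m
  ... | no x≰m = subst Position (cong suc (m+[n∸m]≡n (≰⇒> x≰m))) (descending (x ∸ suc m))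

  descending-succ : ∀ j → suc (k + j) ≡ k + suc j
  descending-succ j = cong (λ q → suc (suc q)) (sym (+-suc m j))

  start-prev : 1 ∸ a ≡ fold (prev 0)
  start-prev with zero-or-suc (a + t)
  ... | inj₁ a+t≡0 = begin
      1 ∸ a              ≡⟨ cong (1 ∸_) (m+n≡0⇒m≡0 a a+t≡0) ⟩
      1                  ≡⟨ cong suc (sym m≡0) ⟩
      suc m              ≡⟨ sym (fold-up (suc m) ≤-refl) ⟩
      fold (suc m)       ≡⟨ cong (λ q → fold (suc q)) (sym (+-zeroʳ-at {m} a+t≡0)) ⟩
      fold (prev 0)      ∎
    where
      m≡0 : m ≡ 0
      m≡0 = n≤0⇒n≡0 (subst (m ≤_) (m+n≡0⇒n≡0 a a+t≡0) m≤t)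
  ... | inj₂ (e , a+t≡1+e) = begin
      1 ∸ a              ≡⟨ sym (bottom-value a≤1 a+t≡1+e) ⟩
      t ∸ e              ≡⟨ sym (fold-down e) ⟩
      fold (k + e)       ≡⟨ cong (λ q → fold (suc q)) (sym (trans (cong (m +_) a+t≡1+e) (+-suc m e))) ⟩
      fold (prev 0)      ∎

  top-next : t ≡ fold (next (suc m))
  top-next with zero-or-suc (a + t)
  ... | inj₁ a+t≡0 = begin
      t                       ≡⟨ m+n≡0⇒n≡0 a a+t≡0 ⟩
      0                       ≡⟨ cong fold (sym next-last) ⟩
      fold (next (suc (m + (a + t)))) ≡⟨ cong (λ q → fold (next (suc q))) (+-zeroʳ-at {m} a+t≡0) ⟩
      fold (next (suc m))     ∎
  ... | inj₂ (e , a+t≡1+e) = begin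
      t                       ≡⟨ sym fold-top ⟩
      fold k                  ≡⟨ cong fold (sym (next-below (suc m) k<L)) ⟩
      fold (next (suc m))     ∎
    where
      k<L : k < L
      k<L = s≤s (s≤s (m<m+n m (subst (0 <_) (sym a+t≡1+e) (s≤s z≤n))))

  ascending-next : ∀ x → x ≤ m → n₂ (suc x) ≡ fold (next (suc x))
  ascending-next x x≤m with m≤n⇒m<n∨m≡n x≤m
  ... | inj₁ x<m = begin
      n₂ (suc x)              ≡⟨ n₂-below (suc x) x<m ⟩
      suc (suc x)             ≡⟨ sym (fold-up (suc (suc x)) (s≤s x<m)) ⟩
      fold (suc (suc x))      ≡⟨ cong fold (sym (next-below (suc x) (≤-trans (s≤s (s≤s x<m)) k≤L))) ⟩
      fold (next (suc x))     ∎
  ... | inj₂ refl = trans n₂-top top-next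

  descending-prev : ∀ j → j < a + t → n₂ (t ∸ j) ≡ fold (prev (k + j))
  descending-prev zero _ = begin
      n₂ t                    ≡⟨ n₂-t ⟩
      suc m                   ≡⟨ sym (fold-up (suc m) ≤-refl) ⟩
      fold (suc m)            ≡⟨ cong (λ q → fold (suc q)) (sym (+-identityʳ m)) ⟩
      fold (prev (k + 0))     ∎
  descending-prev (suc j) j+1<a+t = begin
      n₂ (t ∸ suc j)          ≡⟨ n₂-below (t ∸ suc j) (≤-trans (∸-monoˡ-≤ (suc j) t≤1+m) (m∸n≤m m j)) ⟩
      suc (t ∸ suc j)         ≡⟨ sym (∸-step (below-top a≤1 j+1<a+t)) ⟩
      t ∸ j                   ≡⟨ sym (fold-down j) ⟩
      fold (k + j)            ≡⟨ cong (λ q → fold (suc q)) (sym (+-suc m j)) ⟩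
      fold (prev (k + suc j)) ∎

  descending-next : ∀ j → j < a + t → n₁ (t ∸ j) ≡ fold (next (k + j))
  descending-next j j<a+t with m≤n⇒m<n∨m≡n j<a+t
  ... | inj₁ j+1<a+t = begin
      n₁ (t ∸ j)              ≡⟨ cong n₁ (∸-step (below-top a≤1 j+1<a+t)) ⟩
      t ∸ suc j               ≡⟨ sym (fold-down (suc j)) ⟩
      fold (k + suc j)        ≡⟨ cong fold (sym (descending-succ j)) ⟩
      fold (suc (k + j))      ≡⟨ cong fold (sym (next-below (k + j) bound)) ⟩
      fold (next (k + j))     ∎
    where
      bound : suc (k + j) < L
      bound = subst (_< L) (sym (descending-succ j)) (+-monoʳ-< k j+1<a+t)
  ... | inj₂ j+1≡a+t = begin
      n₁ (t ∸ j)              ≡⟨ cong n₁ (bottom-value a≤1 (sym j+1≡a+t)) ⟩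
      n₁ (1 ∸ a)              ≡⟨ n₁-bottom ⟩
      0                       ≡⟨ cong fold (sym next-last) ⟩
      fold (next (suc (m + (a + t)))) ≡⟨ cong (λ q → fold (next q)) (sym last-position) ⟩
      fold (next (k + j))     ∎
    where
      last-position : k + j ≡ suc (m + (a + t))
      last-position = cong suc (trans (sym (+-suc m j)) (cong (m +_) j+1≡a+t))

  good : ∀ y → y < L → SlotsMatch n₁ n₂ fold y
  good y y<L with position y
  ... | start = inj₁ (start-prev , trans (n₂-below 0 z≤n) (sym (fold-up 1 (s≤s z≤n))))
  ... | ascending x x≤m = inj₁ (trans (cong n₁ at-x+1) (sym (fold-up x (m≤n⇒m≤1+n x≤m))) ,
                                trans (cong n₂ at-x+1) (ascending-next x x≤m))
    where
      at-x+1 : fold (suc x) ≡ suc x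
      at-x+1 = fold-up (suc x) (s≤s x≤m)
  ... | descending j = inj₂ (trans (cong n₁ (fold-down j)) (descending-next j j<a+t) ,
                             trans (cong n₂ (fold-down j)) (descending-prev j j<a+t))
    where
      j<a+t : j < a + t
      j<a+t = +-cancelˡ-< k j (a + t) y<L

-- P_k: reflect at both ends (t = m, a = 0), L = 2k - 2.
module PathInstance (m : ℕ) where
  open PathCover m m 0 ≤-refl (n≤1+n m) z≤n

  decode : ∀ i j → Adj (P k) i j ⇔ Step (toℕ i) (toℕ j)
  decode i j = ∨-⇔ (≡ᵇ-true _ _) (≡ᵇ-true _ _)

  path-slots : ∀ x z → z < k → Step x z ⇔ (z ≡ n₁ x ⊎ z ≡ n₂ x)
  path-slots x z z<k = mk⇔ (step-slot x z z<k) filled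
    where
      filled : z ≡ n₁ x ⊎ z ≡ n₂ x → Step x z
      filled (inj₁ e) with slot₁ x z e
      ... | inj₁ (refl , refl) = inj₁ refl
      ... | inj₂ z+1≡x = inj₂ z+1≡x
      filled (inj₂ e) with slot₂ x z e
      ... | inj₁ (refl , refl) = inj₂ refl
      ... | inj₂ x+1≡z = inj₁ x+1≡z

  open Folding k≤L (Adj (P k)) n₁ n₂ (λ i j → path-slots (toℕ i) (toℕ j) (toℕ<n j) ⇔-∘ decode i j)
               fold fold< fold-id

  invariance : SubdivisionInvariant (P k) L
  invariance = Cover.cover-invariance (P k) φ (φ-nbr good) φ-onto

-- P_k*: loop at the top (t = m + 1, a = 0), L = 2k - 1.
module LoopedPathInstance (m : ℕ) where
  open PathCover m (suc m) 0 (n≤1+n m) ≤-refl z≤n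

  TopLoop : ℕ → ℕ → Set
  TopLoop x z = x ≡ suc m × z ≡ suc m

  decode : ∀ i j → Adj (P* k) i j ⇔ (Step (toℕ i) (toℕ j) ⊎ TopLoop (toℕ i) (toℕ j))
  decode i j = ∨-⇔ (∨-⇔ (≡ᵇ-true _ _) (≡ᵇ-true _ _)) (∧-⇔ (≡ᵇ-true _ _) (≡ᵇ-true _ _))

  path-slots : ∀ x z → z < k → (Step x z ⊎ TopLoop x z) ⇔ (z ≡ n₁ x ⊎ z ≡ n₂ x)
  path-slots x z z<k = mk⇔ slot filled
    where
      slot : Step x z ⊎ TopLoop x z → z ≡ n₁ x ⊎ z ≡ n₂ x
      slot (inj₁ s) = step-slot x z z<k s
      slot (inj₂ (refl , refl)) = inj₂ (sym n₂-top)
      filled : z ≡ n₁ x ⊎ z ≡ n₂ x → Step x z ⊎ TopLoop x z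
      filled (inj₁ e) with slot₁ x z e
      ... | inj₁ (refl , refl) = inj₁ (inj₁ refl)
      ... | inj₂ z+1≡x = inj₁ (inj₂ z+1≡x)
      filled (inj₂ e) with slot₂ x z e
      ... | inj₁ (refl , refl) = inj₂ (refl , refl)
      ... | inj₂ x+1≡z = inj₁ (inj₁ x+1≡z)

  open Folding k≤L (Adj (P* k)) n₁ n₂ (λ i j → path-slots (toℕ i) (toℕ j) (toℕ<n j) ⇔-∘ decode i j)
               fold fold< fold-id

  invariance : SubdivisionInvariant (P* k) L
  invariance = Cover.cover-invariance (P* k) φ (φ-nbr good) φ-onto

-- P_k**: loops at both ends (t = m + 1, a = 1), L = 2k.
module DoublyLoopedPathInstance (m : ℕ) where
  open PathCover m (suc m) 1 (n≤1+n m) ≤-refl ≤-refl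

  BottomLoop TopLoop : ℕ → ℕ → Set
  BottomLoop x z = x ≡ 0 × z ≡ 0
  TopLoop x z = x ≡ suc m × z ≡ suc m

  decode : ∀ i j → Adj (P** k) i j ⇔ ((Step (toℕ i) (toℕ j) ⊎ BottomLoop (toℕ i) (toℕ j)) ⊎ TopLoop (toℕ i) (toℕ j))
  decode i j = ∨-⇔ (∨-⇔ (∨-⇔ (≡ᵇ-true _ _) (≡ᵇ-true _ _)) (∧-⇔ (≡ᵇ-true _ _) (≡ᵇ-true _ _)))
                   (∧-⇔ (≡ᵇ-true _ _) (≡ᵇ-true _ _))

  path-slots : ∀ x z → z < k → ((Step x z ⊎ BottomLoop x z) ⊎ TopLoop x z) ⇔ (z ≡ n₁ x ⊎ z ≡ n₂ x)
  path-slots x z z<k = mk⇔ slot filled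
    where
      slot : (Step x z ⊎ BottomLoop x z) ⊎ TopLoop x z → z ≡ n₁ x ⊎ z ≡ n₂ x
      slot (inj₁ (inj₁ s)) = step-slot x z z<k s
      slot (inj₁ (inj₂ (refl , refl))) = inj₁ refl
      slot (inj₂ (refl , refl)) = inj₂ (sym n₂-top)
      filled : z ≡ n₁ x ⊎ z ≡ n₂ x → (Step x z ⊎ BottomLoop x z) ⊎ TopLoop x z
      filled (inj₁ e) with slot₁ x z e
      ... | inj₁ (refl , refl) = inj₁ (inj₂ (refl , refl))
      ... | inj₂ z+1≡x = inj₁ (inj₁ (inj₂ z+1≡x))
      filled (inj₂ e) with slot₂ x z e
      ... | inj₁ (refl , refl) = inj₂ (refl , refl)
      ... | inj₂ x+1≡z = inj₁ (inj₁ (inj₁ x+1≡z))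

  open Folding k≤L (Adj (P** k)) n₁ n₂ (λ i j → path-slots (toℕ i) (toℕ j) (toℕ<n j) ⇔-∘ decode i j)
               fold fold< fold-id

  invariance : SubdivisionInvariant (P** k) L
  invariance = Cover.cover-invariance (P** k) φ (φ-nbr good) φ-onto

-- The subdivision counts of Defs are the cover lengths; 2k is that of P_k**.
twice : ∀ m → 2 * suc (suc m) ≡ suc (suc (m + suc (suc m)))
twice m = cong (λ q → suc (suc (m + q))) (+-identityʳ (suc (suc m)))

count-path : ∀ m → subdivCount path (suc (suc m)) ≡ suc (suc (m + m))
count-path m = trans (cong (_∸ 2) (twice m)) (trans (+-suc m (suc m)) (cong suc (+-suc m m)))

count-path* : ∀ m → subdivCount path* (suc (suc m)) ≡ suc (suc (m + suc m))
count-path* m = trans (cong (_∸ 1) (twice m)) (cong suc (+-suc m (suc m)))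

lemma5 : (k : ℕ) → 2 ≤ k → (hp : Pair) → (G : Graph) → (u v : V G) → Adj G u v →
    HRoleColouring (targetGraph hp k) G
      ⇔ HRoleColouring (targetGraph hp k) (subdivide G u v (subdivCount hp k))
lemma5 (suc zero) (s≤s ())
lemma5 (suc (suc m)) _ cyc    = CycleCover.cycle-invariance m
lemma5 (suc (suc m)) _ path   =
  subst (SubdivisionInvariant (P _)) (sym (count-path m)) (PathInstance.invariance m)
lemma5 (suc (suc m)) _ path*  =
  subst (SubdivisionInvariant (P* _)) (sym (count-path* m)) (LoopedPathInstance.invariance m)
lemma5 (suc (suc m)) _ path** =
  subst (SubdivisionInvariant (P** _)) (sym (twice m)) (DoublyLoopedPathInstance.invariance m)
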